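{- The set $R\subseteq\{0,1\}^*$ of finite $0/1$-words that are removable in the no-gaps coin-removal process is a regular language (it is recognized by a deterministic finite automaton).
   Context: Words over $\{0,1\}$ encode rows of coins, $1$ = heads-up, $0$ = tails-up. A move removes a heads-up coin, flips the coins immediately to its left and right (those that exist), and then pushes the remaining coins together so that coins formerly on either side of the removed coin become adjacent. A word is removable if some sequence of moves removes all coins. -}

module Defs where

open import Data.Bool using (Bool; true; false; not)
open import Data.List using (List; []; _∷_; _++_; foldl)
open import Data.Nat using (ℕ)
open import Data.Fin using (Fin)
open import Relation.Binary.PropositionalEquality using (_≡_)

-- A coin row: true = heads-up (1), false = tails-up (0).
Word : Set
Word = List Bool

flipFirst : Word → Word
flipFirst []       = []
flipFirst (b ∷ bs) = not b ∷ bs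

flipLast : Word → Word
flipLast []           = []
flipLast (b ∷ [])     = not b ∷ []
flipLast (b ∷ c ∷ bs) = b ∷ flipLast (c ∷ bs)

-- One move: remove a heads-up coin, flip its (existing) neighbours,
-- and push the remaining coins together (no gaps).
data Move : Word → Word → Set where
  move : (u v : Word) → Move (u ++ true ∷ v) (flipLast u ++ flipFirst v)

data Removable : Word → Set where
  done : Removable []
  step : ∀ {w w'} → Move w w' → Removable w' → Removable w

record DFA (n : ℕ) : Set where
  field
    start  : Fin n
    delta  : Fin n → Bool → Fin n
    accept : Fin n → Bool

run : ∀ {n} → DFA n → Fin n → Word → Fin n
run A q w = foldl (DFA.delta A) q w

Accepts : ∀ {n} → DFA n → Word → Set
Accepts A w = DFA.accept A (run A (DFA.start A) w) ≡ true

{-# OPTIONS --safe #-}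
-- A move only changes the row next to the removed heads, and the three-state automaton `charge`
-- is built so that such a change never affects acceptance: reading b 1 d acts like reading
-- (not b) (not d), and at the ends of the row the two readings at least agree on acceptance.
-- Hence removable words are charged, and nonempty ones contain a heads. Conversely, every word
-- with a heads other than 11 has a move leaving the empty row or a row with a heads; as `charge`
-- rejects 11 and is invariant under moves, repeating such moves removes every charged word
-- containing a heads. The required DFA is the product of these two conditions.
module Submission where

open import Defs
open import Data.Bool using (Bool; true; false; not; _∧_)
open import Data.Bool.Properties using (∧-conicalˡ; ∧-conicalʳ)
open import Data.Empty using (⊥-elim)
open import Data.Fin using (Fin; combine; remQuot)
open import Data.Fin.Patterns using (0F; 1F; 2F)
open import Data.Fin.Properties using (remQuot-combine)
open import Data.List using (List; []; _∷_; _++_; length)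
open import Data.List.Properties using (length-++)
open import Data.List.Membership.Propositional using (_∈_)
open import Data.List.Membership.Propositional.Properties using (∈-++⁺ʳ)
open import Data.List.Relation.Unary.Any using (here; there)
open import Data.Nat using (ℕ; suc; _+_; _*_; _<_)
open import Data.Nat.Induction using (<-wellFounded)
open import Data.Nat.Properties using (≤-reflexive; +-suc)
open import Data.Product using (Σ; _×_; _,_; ∃₂; uncurry)
open import Data.Product.Function.NonDependent.Propositional using (_×-⇔_)
open import Data.Sum using (_⊎_; inj₁; inj₂; [_,_]′; map₂)
open import Function using (_∘_)
open import Function.Bundles using (_⇔_; mk⇔; Equivalence)
open import Function.Construct.Composition using (_⇔-∘_)
open import Function.Construct.Identity using (⇔-id)
open import Function.Construct.Symmetry using (⇔-sym)
open import Induction.WellFounded using (Acc; acc)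
open import Relation.Nullary using (contradiction)
open import Relation.Binary.PropositionalEquality
  using (_≡_; _≢_; refl; sym; trans; cong; cong₂; subst; module ≡-Reasoning)

open DFA
open Equivalence using (to; from)

_∩_ : ∀ {m n} → DFA m → DFA n → DFA (m * n)
_∩_ {n = n} A B = record
  { start  = combine (start A) (start B)
  ; delta  = λ q b → uncurry (λ p r → combine (delta A p b) (delta B r b)) (remQuot n q)
  ; accept = λ q → uncurry (λ p r → accept A p ∧ accept B r) (remQuot n q)
  }

module _ {m n} (A : DFA m) (B : DFA n) where

  delta-∩ : ∀ p r b → delta (A ∩ B) (combine p r) b ≡ combine (delta A p b) (delta B r b)
  delta-∩ p r b = cong (uncurry (λ p r → combine (delta A p b) (delta B r b))) (remQuot-combine p r)

  accept-∩ : ∀ p r → accept (A ∩ B) (combine p r) ≡ accept A p ∧ accept B r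
  accept-∩ p r = cong (uncurry (λ p r → accept A p ∧ accept B r)) (remQuot-combine p r)

  run-∩ : ∀ p r w → run (A ∩ B) (combine p r) w ≡ combine (run A p w) (run B r w)
  run-∩ p r []      = refl
  run-∩ p r (b ∷ w) =
    trans (cong (λ q → run (A ∩ B) q w) (delta-∩ p r b)) (run-∩ (delta A p b) (delta B r b) w)

  Accepts-∩ : ∀ w → Accepts (A ∩ B) w ⇔ (Accepts A w × Accepts B w)
  Accepts-∩ w = mk⇔
    (λ e → let e′ = trans (sym accepted) e in ∧-conicalˡ _ _ e′ , ∧-conicalʳ _ _ e′)
    (λ (a , b) → trans accepted (cong₂ _∧_ a b))
    where
    accepted : accept (A ∩ B) (run (A ∩ B) (start (A ∩ B)) w)
             ≡ accept A (run A (start A) w) ∧ accept B (run B (start B) w)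
    accepted = trans (cong (accept (A ∩ B)) (run-∩ (start A) (start B) w)) (accept-∩ _ _)

-- States: 0F nothing read, 1F only tails read, 2F some heads read.
emptyOrHeads : DFA 3
emptyOrHeads = record { start = 0F ; delta = δ ; accept = λ { 1F → false ; _ → true } }
  where
  δ : Fin 3 → Bool → Fin 3
  δ _  true  = 2F
  δ 2F false = 2F
  δ _  false = 1F

run-emptyOrHeads-2F : ∀ w → run emptyOrHeads 2F w ≡ 2F
run-emptyOrHeads-2F []          = refl
run-emptyOrHeads-2F (true ∷ w)  = run-emptyOrHeads-2F w
run-emptyOrHeads-2F (false ∷ w) = run-emptyOrHeads-2F w

run-emptyOrHeads-heads : ∀ q {w} → true ∈ w → run emptyOrHeads q w ≡ 2F
run-emptyOrHeads-heads q {true ∷ w} (here refl) = run-emptyOrHeads-2F w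
run-emptyOrHeads-heads q {_ ∷ w}    (there p)   = run-emptyOrHeads-heads _ p

run-emptyOrHeads-1F : ∀ w → run emptyOrHeads 1F w ≡ 1F ⊎ true ∈ w
run-emptyOrHeads-1F []          = inj₁ refl
run-emptyOrHeads-1F (true ∷ w)  = inj₂ (here refl)
run-emptyOrHeads-1F (false ∷ w) = map₂ there (run-emptyOrHeads-1F w)

accepts-emptyOrHeads : ∀ w → Accepts emptyOrHeads w ⇔ (w ≡ [] ⊎ true ∈ w)
accepts-emptyOrHeads w =
  mk⇔ (accepted w) [ (λ { refl → refl }) , cong (accept emptyOrHeads) ∘ run-emptyOrHeads-heads 0F ]′
  where
  accepted : ∀ w → Accepts emptyOrHeads w → w ≡ [] ⊎ true ∈ w
  accepted []          _ = inj₁ refl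
  accepted (true ∷ w)  _ = inj₂ (here refl)
  accepted (false ∷ w) a with run-emptyOrHeads-1F w
  ... | inj₁ stuck = contradiction (trans (cong (accept emptyOrHeads) (sym stuck)) a) λ ()
  ... | inj₂ p     = inj₂ (there p)

-- States are residues mod 3: tails negates the state, heads decrements it.
charge : DFA 3
charge = record { start = 1F ; delta = δ ; accept = λ { 2F → false ; _ → true } }
  where
  δ : Fin 3 → Bool → Fin 3
  δ 0F false = 0F
  δ 1F false = 2F
  δ 2F false = 1F
  δ 0F true  = 2F
  δ 1F true  = 0F
  δ 2F true  = 1F

charged : Fin 3 → Word → Bool
charged q w = accept charge (run charge q w)

run-charge-heads-between : ∀ q b d →
  run charge q (b ∷ true ∷ d ∷ []) ≡ run charge q (not b ∷ not d ∷ [])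
run-charge-heads-between 0F false false = refl
run-charge-heads-between 0F false true  = refl
run-charge-heads-between 0F true  false = refl
run-charge-heads-between 0F true  true  = refl
run-charge-heads-between 1F false false = refl
run-charge-heads-between 1F false true  = refl
run-charge-heads-between 1F true  false = refl
run-charge-heads-between 1F true  true  = refl
run-charge-heads-between 2F false false = refl
run-charge-heads-between 2F false true  = refl
run-charge-heads-between 2F true  false = refl
run-charge-heads-between 2F true  true  = refl

charged-heads-last : ∀ q b → charged q (b ∷ true ∷ []) ≡ charged q (not b ∷ [])
charged-heads-last 0F false = refl
charged-heads-last 0F true  = refl
charged-heads-last 1F false = refl
charged-heads-last 1F true  = refl
charged-heads-last 2F false = refl
charged-heads-last 2F true  = refl

run-charge-heads-first : ∀ d → run charge 1F (true ∷ d ∷ []) ≡ run charge 1F (not d ∷ [])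
run-charge-heads-first false = refl
run-charge-heads-first true  = refl

charged-move-after : ∀ q b u v →
  charged q (b ∷ u ++ true ∷ v) ≡ charged q (flipLast (b ∷ u) ++ flipFirst v)
charged-move-after q b []      []      = charged-heads-last q b
charged-move-after q b []      (d ∷ v) = cong (λ q′ → charged q′ v) (run-charge-heads-between q b d)
charged-move-after q b (c ∷ u) v       = charged-move-after (delta charge q b) c u v

charged-Move : ∀ {w w′} → Move w w′ → charged 1F w ≡ charged 1F w′
charged-Move (move []      [])      = refl
charged-Move (move []      (d ∷ v)) = cong (λ q → charged q v) (run-charge-heads-first d)
charged-Move (move (b ∷ u) v)       = charged-move-after 1F b u v

length-flipLast : ∀ u → length (flipLast u) ≡ length u
length-flipLast []          = refl
length-flipLast (_ ∷ [])    = refl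
length-flipLast (_ ∷ c ∷ u) = cong suc (length-flipLast (c ∷ u))

length-flipFirst : ∀ v → length (flipFirst v) ≡ length v
length-flipFirst []      = refl
length-flipFirst (_ ∷ _) = refl

Move-shortens : ∀ {w w′} → Move w w′ → length w′ < length w
Move-shortens (move u v) = ≤-reflexive (begin
  suc (length (flipLast u ++ flipFirst v))
    ≡⟨ cong suc (length-++ (flipLast u)) ⟩
  suc (length (flipLast u) + length (flipFirst v))
    ≡⟨ cong₂ (λ x y → suc (x + y)) (length-flipLast u) (length-flipFirst v) ⟩
  suc (length u + length v)
    ≡⟨ sym (+-suc (length u) (length v)) ⟩
  length u + length (true ∷ v)
    ≡⟨ sym (length-++ u) ⟩
  length (u ++ true ∷ v)
    ∎)
  where open ≡-Reasoning

Move-heads : ∀ {w w′} → Move w w′ → true ∈ w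
Move-heads (move u v) = ∈-++⁺ʳ u (here refl)

HeadsKeepingMove : Word → Set
HeadsKeepingMove w = Σ Word λ w′ → Move w w′ × (w′ ≡ [] ⊎ true ∈ w′)

-- Removing the first heads of w flips the tails just before it into a heads.
tails-then-heads : ∀ w → true ∈ w →
  ∃₂ λ u v → false ∷ w ≡ u ++ true ∷ v × true ∈ flipLast u ++ flipFirst v
tails-then-heads (true ∷ v)  _         = false ∷ [] , v , refl , here refl
tails-then-heads (false ∷ w) (there p) with tails-then-heads w p
... | c ∷ u , v , eq , q = false ∷ c ∷ u , v , cong (false ∷_) eq , there q

headsKeepingMove : ∀ w → true ∈ w → w ≢ true ∷ true ∷ [] → HeadsKeepingMove w
headsKeepingMove (true ∷ [])               _ _    = _ , move [] [] , inj₁ refl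
headsKeepingMove (true ∷ false ∷ v)        _ _    = _ , move [] (false ∷ v) , inj₂ (here refl)
headsKeepingMove (true ∷ true ∷ [])        _ w≢11 = ⊥-elim (w≢11 refl)
headsKeepingMove (true ∷ true ∷ true ∷ v)  _ _    = _ , move [] (true ∷ true ∷ v) , inj₂ (there (here refl))
headsKeepingMove (true ∷ true ∷ false ∷ v) _ _    = _ , move (true ∷ []) (false ∷ v) , inj₂ (there (here refl))
headsKeepingMove (false ∷ w) (there p) _ with tails-then-heads w p
... | u , v , eq , q = _ , subst (λ x → Move x (flipLast u ++ flipFirst v)) (sym eq) (move u v) , inj₂ q

removable-if-charged : ∀ w → Acc _<_ (length w) → true ∈ w → Accepts charge w → Removable w
removable-if-charged w (acc rs) h c with headsKeepingMove w h (λ { refl → contradiction c λ () })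
... | _  , m , inj₁ refl = step m done
... | w′ , m , inj₂ h′   =
  step m (removable-if-charged w′ (rs (Move-shortens m)) h′ (trans (sym (charged-Move m)) c))

removable⇔ : ∀ w → Removable w ⇔ ((w ≡ [] ⊎ true ∈ w) × Accepts charge w)
removable⇔ w = mk⇔ (λ r → emptyOrHeads-removable r , charged-removable r) (uncurry removable)
  where
  emptyOrHeads-removable : ∀ {w} → Removable w → w ≡ [] ⊎ true ∈ w
  emptyOrHeads-removable done       = inj₁ refl
  emptyOrHeads-removable (step m _) = inj₂ (Move-heads m)

  charged-removable : ∀ {w} → Removable w → Accepts charge w
  charged-removable done       = refl
  charged-removable (step m r) = trans (charged-Move m) (charged-removable r)

  removable : w ≡ [] ⊎ true ∈ w → Accepts charge w → Removable w
  removable (inj₁ refl) _ = done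
  removable (inj₂ h)    c = removable-if-charged w (<-wellFounded _) h c

mainTheorem6 : Σ ℕ λ n → Σ (DFA n) λ A →
    ((w : List Bool) → Accepts A w → Removable w) ×
    ((w : List Bool) → Removable w → Accepts A w)
mainTheorem6 = 9 , emptyOrHeads ∩ charge , to ∘ accepted⇔removable , from ∘ accepted⇔removable
  where
  accepted⇔removable : ∀ w → Accepts (emptyOrHeads ∩ charge) w ⇔ Removable w
  accepted⇔removable w =
    ⇔-sym (removable⇔ w) ⇔-∘ ((accepts-emptyOrHeads w ×-⇔ ⇔-id _) ⇔-∘ Accepts-∩ emptyOrHeads charge w)
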